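{- Let $p>5$ be a prime. All congruences below are between rational numbers whose denominators are prime to $p$, taken modulo $p$ (i.e. in $\mathbb{Z}_{(p)}$). For odd integers $m$ (positive or negative) put $\left(\frac{ -1}{m}\right):=(-1)^{(m-1)/2}$, and let $\left(\frac{a}{5}\right)$ denote the Legendre symbol modulo $5$. Define $$A(p)=\begin{cases} 2\left(\frac{ -1}{p}\right)\displaystyle\sum_{\substack{j=-p+1\\ j\equiv 5,7 \bmod 10}}^{p-1}\frac{\left(\frac{j+1}{5}\right)\left(\frac{ -1}{j}\right)}{p-j}, & p\equiv \pm1 \pmod 5,\\[3ex] 2\left(\frac{ -1}{p}\right)\displaystyle\sum_{\substack{j=-p+1\\ j\equiv 1,5 \bmod 10}}^{p-1}\frac{\left(\frac{j+1}{5}\right)\left(\frac{ -1}{j}\right)}{p-j}, & p\equiv \pm2 \pmod 5.\end{cases}$$ Then $$A(p)\equiv \frac{2}{5}\sum_{j=\lfloor p/5\rfloor+1}^{\lfloor 2p/5\rfloor}\frac{1}{j} \pmod p.$$ Consequently, Andrews's congruence $F_{p-\left(\frac{5}{p}\right)}/p\equiv A(p)\pmod p$ implies Williams's congruence $$F_{p-\left(\frac{5}{p}\right)}/p\equiv \frac{2}{5}\sum_{j=\lfloor p/5\rfloor+1}^{\lfloor 2p/5\rfloor}\frac{1}{j}\pmod p .$$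
   Context: $F_n$ denotes the $n$-th Fibonacci number ($F_0=0$, $F_1=1$, $F_{n+1}=F_n+F_{n-1}$), and $\left(\frac{5}{p}\right)$ is the Legendre symbol, equal to $1$ if $p\equiv\pm1\pmod 5$ and $-1$ if $p\equiv\pm2\pmod5$. The convention $\left(\frac{ -1}{m}\right)=(-1)^{(m-1)/2}$ is used for all odd integers $m$, including $m=p$ and negative $m$. -}

module Defs where

open import Data.Nat as ℕ using (ℕ; zero; suc; _∸_; _≡ᵇ_)
open import Data.Nat.DivMod using (_/_; _%_)
open import Data.Bool using (Bool; true; false; if_then_else_; _∨_)
open import Data.Integer as ℤ using (ℤ; +_; -[1+_]; ∣_∣)
open import Data.Integer.Divisibility using (_∣_)
open import Data.Integer.DivMod using (_%ℕ_)
open import Data.List using (List; []; _∷_; map; foldr; upTo)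
open import Data.Rational as ℚ using (ℚ; 0ℚ; ↥_)

fib : ℕ → ℕ
fib zero = 0
fib (suc zero) = 1
fib (suc (suc n)) = fib (suc n) ℕ.+ fib n

-- the rational number n / d (d > 0 in all uses; the d = 0 case is a dummy)
frac : ℤ → ℕ → ℚ
frac n zero = 0ℚ
frac n (suc d) = n ℚ./ suc d

sumℚ : List ℚ → ℚ
sumℚ = foldr ℚ._+_ 0ℚ

-- congruence of rationals modulo p in Z_(p): p divides the numerator of the
-- reduced fraction x - y (this forces the denominator of x - y to be prime to p)
_≡_[modℚ_] : ℚ → ℚ → ℕ → Set
x ≡ y [modℚ p ] = (+ p) ∣ (↥ (x ℚ.- y))

leg5 : ℤ → ℤ
leg5 a with a %ℕ 5
... | 0 = + 0
... | 1 = + 1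
... | 4 = + 1
... | _ = ℤ.- (+ 1)

-- (-1 / m) = (-1)^((m-1)/2) for odd integers m (positive or negative);
-- computed as 1 if m ≡ 1 (mod 4) and -1 if m ≡ 3 (mod 4)
legM1 : ℤ → ℤ
legM1 m with m %ℕ 4
... | 1 = + 1
... | _ = ℤ.- (+ 1)

-- Legendre symbol (5 / p) for a prime p ≠ 5: 1 if p ≡ ±1 (mod 5), -1 otherwise
leg5p : ℕ → ℤ
leg5p p = leg5 (+ p)

intRange : ℕ → List ℤ
intRange p = map (λ k → (+ k) ℤ.- (+ (p ∸ 1))) (upTo (2 ℕ.* p ∸ 1))

inClass : ℕ → ℤ → Bool
inClass p j with p % 5
... | 1 = (j %ℕ 10 ≡ᵇ 5) ∨ (j %ℕ 10 ≡ᵇ 7)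
... | 4 = (j %ℕ 10 ≡ᵇ 5) ∨ (j %ℕ 10 ≡ᵇ 7)
... | _ = (j %ℕ 10 ≡ᵇ 1) ∨ (j %ℕ 10 ≡ᵇ 5)

termA : ℕ → ℤ → ℚ
termA p j = if inClass p j
  then frac (leg5 (j ℤ.+ + 1) ℤ.* legM1 j) ∣ (+ p) ℤ.- j ∣
  else 0ℚ

A : ℕ → ℚ
A p = frac (+ 2 ℤ.* legM1 (+ p)) 1 ℚ.* sumℚ (map (termA p) (intRange p))

natRange : ℕ → ℕ → List ℕ
natRange a b = map (a ℕ.+_) (upTo (suc b ∸ a))

W : ℕ → ℚ
W p = frac (+ 2) 5 ℚ.* sumℚ (map (λ j → frac (+ 1) j) (natRange (suc (p / 5)) ((2 ℕ.* p) / 5)))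

fibQuot : ℕ → ℚ
fibQuot p = frac (+ fib ∣ (+ p) ℤ.- leg5p p ∣) p

-- Folding the range of A(p) with 1/(p + m) ≡ 1/m writes 5 A(p) as ∑_{0<m<p} c(m)/m with integer weights c(m), while
-- 5 W = 2 ∑_{p<5m<2p} 1/m. For 0 < m < p both weights depend only on p mod 20, m mod 20 and ⌊20m/p⌋. For each of the
-- eight classes of p mod 20, a computer-found certificate writes their difference as an integer combination of
-- weights whose sums ∑ w(m)/m vanish mod p: the classical relations
-- ∑_{tp/N<m<(t+1)p/N} 1/m ≡ N ∑_{m ≡ -tp (mod N)} 1/m for N = 10, 20, and weights X(m) + X(p - m), which vanish
-- because 1/m + 1/(p - m) ≡ 0. The certificate is verified by evaluation over all residues, and dividing by 5
-- gives A(p) ≡ W.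

module Submission where

open import Defs
open import Data.Nat using (ℕ; _<_)
open import Data.Nat.Primality using (Prime)
open import Data.Product using (_×_)

open import Data.Bool using (true; false; if_then_else_; _∨_)
open import Data.Fin using (Fin; toℕ; fromℕ<)
import Data.Fin.Properties as Fin
open import Data.Fin.Properties using (toℕ-fromℕ<)
open import Data.List using (List; []; _∷_; _++_; map; applyUpTo; upTo)
open import Data.List.Properties using (map-applyUpTo)
open import Data.List.Relation.Unary.All as All using (All)
open import Data.Nat as ℕ using (zero; suc; _≤_; _<?_; _≤?_; _≡ᵇ_; z≤n; s≤s; NonZero; _∸_; _%_)
import Data.Nat.Properties as ℕP
open import Data.Nat.DivMod
  using (m≡m%n+[m/n]*n; m%n<n; m/n*n≤m; m<n*o⇒m/o<n; /-monoˡ-≤; m*n/n≡m; m*[n/m]≡n; m∣n⇒o%n%m≡o%m)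
open import Data.Nat.Divisibility as ℕ∣ using (_∣_; _∤_; _∣?_; divides; m%n≡0⇒n∣m; n∣m⇒m%n≡0)
open import Data.Nat.Primality using (euclidsLemma; prime⇒nonTrivial; prime⇒¬composite; composite-≢)
import Data.Nat.Coprimality as Coprimality
open import Data.Integer as ℤ using (ℤ; +_; 1ℤ; -1ℤ)
import Data.Integer.Properties as ℤP
open import Data.Integer.DivMod using (_%ℕ_; _/ℕ_; a≡a%ℕn+[a/ℕn]*n; n%ℕd<d)
import Data.Integer.Divisibility as ℤ∣ᵤ
import Data.Integer.Divisibility.Signed as ℤ∣
open import Data.Integer.Solver using (module +-*-Solver)
open import Data.Product using (_,_; proj₁; proj₂)
open import Data.Product.Function.NonDependent.Propositional using (_×-⇔_)
open import Data.Rational as ℚ using (ℚ; toℚᵘ)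
import Data.Rational.Properties as ℚP
open import Data.Rational.Unnormalised
  using (ℚᵘ; mkℚᵘ; ↥_; ↧_; ↧ₙ_; 0ℚᵘ; _+_; _*_; -_; _-_; _/_; _≃_; *≡*)
open import Data.Rational.Unnormalised.Properties
  using ( ≃-refl; ≃-sym; ≃-trans; ≃-reflexive; module ≃-Reasoning; +-cong; +-congʳ; +-congˡ; -‿cong; *-cong; *-congˡ
        ; +-identityˡ; +-identityʳ; +-assoc; +-comm; +-inverseʳ; +-minus-telescope; neg-distrib-+
        ; *-assoc; *-zeroʳ; *-distribˡ-+; drop-*≡*)
import Data.Rational.Unnormalised.Solver as ℚᵘ-Solver
open import Data.Sum using (_⊎_; inj₁; inj₂)
open import Function using (_∘_; _$_; _⇔_; mk⇔; Equivalence)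
open import Function.Properties.Equivalence using () renaming (trans to ⇔-trans; sym to ⇔-sym)
open import Relation.Binary using (IsEquivalence; Setoid)
import Relation.Binary.Reasoning.Setoid as SetoidReasoning
open import Relation.Binary.PropositionalEquality
  using (_≡_; _≢_; refl; sym; trans; cong; cong₂; subst; subst₂; module ≡-Reasoning)
open import Relation.Nullary using (¬_; Dec; does; yes; no; _×-dec_; _⊎-dec_; contradiction)
open import Relation.Nullary.Decidable using (dec-true; dec-false; toWitness)
open import Relation.Unary using (Decidable)

-- Finite sums and weighted harmonic sums

∑ : ℕ → (ℕ → ℚᵘ) → ℚᵘ
∑ zero    f = 0ℚᵘ
∑ (suc n) f = f 0 + ∑ n (f ∘ suc)

∑-cong : ∀ n {f g} → (∀ i → i < n → f i ≃ g i) → ∑ n f ≃ ∑ n g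
∑-cong zero    f≃g = ≃-refl
∑-cong (suc n) f≃g = +-cong (f≃g 0 (s≤s z≤n)) (∑-cong n (λ i i<n → f≃g (suc i) (s≤s i<n)))

∑-zero : ∀ n {f} → (∀ i → i < n → f i ≃ 0ℚᵘ) → ∑ n f ≃ 0ℚᵘ
∑-zero zero    f≃0 = ≃-refl
∑-zero (suc n) f≃0 = ≃-trans (+-cong (f≃0 0 (s≤s z≤n)) (∑-zero n (λ i i<n → f≃0 (suc i) (s≤s i<n))))
                             (+-identityˡ 0ℚᵘ)

∑-distrib-+ : ∀ n f g → ∑ n (λ i → f i + g i) ≃ ∑ n f + ∑ n g
∑-distrib-+ zero    f g = ≃-sym (+-identityˡ 0ℚᵘ)
∑-distrib-+ (suc n) f g = begin
  (f 0 + g 0) + ∑ n (λ i → f (suc i) + g (suc i))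
    ≈⟨ +-congʳ (f 0 + g 0) (∑-distrib-+ n (f ∘ suc) (g ∘ suc)) ⟩
  (f 0 + g 0) + (∑ n (f ∘ suc) + ∑ n (g ∘ suc))
    ≈⟨ solve 4 (λ a b c d → (a :+ b) :+ (c :+ d) := (a :+ c) :+ (b :+ d)) ≃-refl
               (f 0) (g 0) (∑ n (f ∘ suc)) (∑ n (g ∘ suc)) ⟩
  (f 0 + ∑ n (f ∘ suc)) + (g 0 + ∑ n (g ∘ suc))
    ∎
  where open ≃-Reasoning
        open ℚᵘ-Solver.+-*-Solver

∑-neg : ∀ n f → ∑ n (λ i → - f i) ≃ - ∑ n f
∑-neg zero    f = ≃-refl
∑-neg (suc n) f = ≃-trans (+-congʳ (- f 0) (∑-neg n (f ∘ suc)))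
                          (≃-sym (≃-reflexive (neg-distrib-+ (f 0) (∑ n (f ∘ suc)))))

∑-distribˡ-* : ∀ n c f → ∑ n (λ i → c * f i) ≃ c * ∑ n f
∑-distribˡ-* zero    c f = ≃-sym (*-zeroʳ c)
∑-distribˡ-* (suc n) c f = ≃-trans (+-congʳ (c * f 0) (∑-distribˡ-* n c (f ∘ suc)))
                                   (≃-sym (*-distribˡ-+ c (f 0) (∑ n (f ∘ suc))))

∑-split : ∀ a b f → ∑ (a ℕ.+ b) f ≃ ∑ a f + ∑ b (λ i → f (a ℕ.+ i))
∑-split zero    b f = ≃-sym (+-identityˡ (∑ b f))
∑-split (suc a) b f = ≃-trans (+-congʳ (f 0) (∑-split a b (f ∘ suc)))
                              (≃-sym (+-assoc (f 0) (∑ a (f ∘ suc)) (∑ b (λ i → f (suc a ℕ.+ i)))))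

∑-last : ∀ n f → ∑ (suc n) f ≃ ∑ n f + f n
∑-last zero    f = ≃-trans (+-identityʳ (f 0)) (≃-sym (+-identityˡ (f 0)))
∑-last (suc n) f = ≃-trans (+-congʳ (f 0) (∑-last n (f ∘ suc)))
                           (≃-sym (+-assoc (f 0) (∑ n (f ∘ suc)) (f (suc n))))

∑-reverse : ∀ n f → ∑ n (λ i → f (n ℕ.∸ suc i)) ≃ ∑ n f
∑-reverse zero    f = ≃-refl
∑-reverse (suc n) f = ≃-trans (+-congʳ (f n) (∑-reverse n f))
                      (≃-trans (+-comm (f n) (∑ n f)) (≃-sym (∑-last n f)))

-- mkℚᵘ z k denotes z / (k + 1), so this is the sum of w m / m over a < m ≤ a + n.
harmonic : (ℕ → ℤ) → ℕ → ℕ → ℚᵘ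
harmonic w a n = ∑ n (λ i → mkℚᵘ (w (suc (a ℕ.+ i))) (a ℕ.+ i))

harmonic-cong : ∀ {w w′} a n → (∀ i → i < n → w (suc (a ℕ.+ i)) ≡ w′ (suc (a ℕ.+ i))) →
                harmonic w a n ≃ harmonic w′ a n
harmonic-cong a n w≡w′ = ∑-cong n (λ i i<n → ≃-reflexive (cong (λ z → mkℚᵘ z (a ℕ.+ i)) (w≡w′ i i<n)))

harmonic-+ : ∀ w w′ a n → harmonic (λ m → w m ℤ.+ w′ m) a n ≃ harmonic w a n + harmonic w′ a n
harmonic-+ w w′ a n = ≃-trans (∑-cong n (λ i _ → term-+ (w (suc (a ℕ.+ i))) (w′ (suc (a ℕ.+ i))) (a ℕ.+ i)))
                              (∑-distrib-+ n _ _)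
  where
  term-+ : ∀ x y k → mkℚᵘ (x ℤ.+ y) k ≃ mkℚᵘ x k + mkℚᵘ y k
  term-+ x y k = *≡* (trans (cong ((x ℤ.+ y) ℤ.*_) (ℤP.pos-* (suc k) (suc k)))
    (solve 3 (λ x y d → (x :+ y) :* (d :* d) := (x :* d :+ y :* d) :* d) refl x y (+ suc k)))
    where open +-*-Solver

harmonic-*ˡ : ∀ c w a n → harmonic (λ m → c ℤ.* w m) a n ≃ c / 1 * harmonic w a n
harmonic-*ˡ c w a n = ≃-trans (∑-cong n (λ i _ → *≡* (cong (λ k → (c ℤ.* w (suc (a ℕ.+ i))) ℤ.* + suc k)
                                                          (ℕP.+-identityʳ (a ℕ.+ i)))))
                              (∑-distribˡ-* n (c / 1) _)

harmonic-neg : ∀ w a n → harmonic (λ m → ℤ.- w m) a n ≃ - harmonic w a n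
harmonic-neg w a n = ∑-neg n _

harmonic-vanish : ∀ w a n → (∀ i → i < n → w (suc (a ℕ.+ i)) ≡ + 0) → harmonic w a n ≃ 0ℚᵘ
harmonic-vanish w a n w≡0 = ∑-zero n (λ i i<n →
  ≃-trans (≃-reflexive (cong (λ z → mkℚᵘ z (a ℕ.+ i)) (w≡0 i i<n))) (*≡* refl))

harmonic-split : ∀ w a b c → harmonic w a (b ℕ.+ c) ≃ harmonic w a b + harmonic w (a ℕ.+ b) c
harmonic-split w a b c = ≃-trans (∑-split b c _) (+-congʳ (harmonic w a b) (∑-cong c (λ i _ →
  ≃-reflexive (cong (λ k → mkℚᵘ (w (suc k)) k) (sym (ℕP.+-assoc a b i))))))

harmonic-dropLast : ∀ w a n → w (suc (a ℕ.+ n)) ≡ + 0 → harmonic w a (suc n) ≃ harmonic w a n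
harmonic-dropLast w a n w≡0 = ≃-trans (∑-last n _)
  (≃-trans (+-congʳ (harmonic w a n) (≃-trans (≃-reflexive (cong (λ z → mkℚᵘ z (a ℕ.+ n)) w≡0)) (*≡* refl)))
           (+-identityʳ (harmonic w a n)))

harmonic-restrict : ∀ w a n b →
                    (∀ i → i < a → w (suc i) ≡ + 0) → (∀ i → i < b → w (suc (a ℕ.+ n ℕ.+ i)) ≡ + 0) →
                    harmonic w 0 (a ℕ.+ (n ℕ.+ b)) ≃ harmonic w a n
harmonic-restrict w a n b below above = begin
  harmonic w 0 (a ℕ.+ (n ℕ.+ b))                   ≈⟨ harmonic-split w 0 a (n ℕ.+ b) ⟩
  harmonic w 0 a + harmonic w a (n ℕ.+ b)          ≈⟨ +-cong (harmonic-vanish w 0 a below) (harmonic-split w a n b) ⟩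
  0ℚᵘ + (harmonic w a n + harmonic w (a ℕ.+ n) b)  ≈⟨ +-identityˡ _ ⟩
  harmonic w a n + harmonic w (a ℕ.+ n) b          ≈⟨ +-congʳ (harmonic w a n) (harmonic-vanish w (a ℕ.+ n) b above) ⟩
  harmonic w a n + 0ℚᵘ                             ≈⟨ +-identityʳ _ ⟩
  harmonic w a n                                   ∎
  where open ≃-Reasoning

dilate : (N : ℕ) .{{_ : NonZero N}} → (ℕ → ℤ) → ℕ → ℤ
dilate N u k = if does (N ∣? k) then + N ℤ.* u (k ℕ./ N) else + 0

dilate-block : ∀ N₁ u s → harmonic (dilate (suc N₁) u) (s ℕ.* suc N₁) (suc N₁) ≃ mkℚᵘ (u (suc s)) s
dilate-block N₁ u s = ≃-trans (∑-last N₁ _)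
  (≃-trans (+-congˡ last (harmonic-vanish (dilate N u) (s ℕ.* N) N₁ off-block)) (≃-trans (+-identityˡ last) last≃))
  where
  N = suc N₁
  k≡ : suc (s ℕ.* N ℕ.+ N₁) ≡ suc s ℕ.* N
  k≡ = trans (sym (ℕP.+-suc (s ℕ.* N) N₁)) (ℕP.+-comm (s ℕ.* N) N)
  last = mkℚᵘ (dilate N u (suc (s ℕ.* N ℕ.+ N₁))) (s ℕ.* N ℕ.+ N₁)
  off-block : ∀ i → i < N₁ → dilate N u (suc (s ℕ.* N ℕ.+ i)) ≡ + 0
  off-block i i<N₁ = cong (λ b → if b then + N ℤ.* u (suc (s ℕ.* N ℕ.+ i) ℕ./ N) else + 0)
                           (dec-false (N ∣? _) N∤)
    where
    N∤ : ¬ N ∣ suc (s ℕ.* N ℕ.+ i)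
    N∤ N∣ = ℕ∣.>⇒∤ (s≤s i<N₁)
                   (ℕ∣.∣m+n∣m⇒∣n (subst (N ∣_) (sym (ℕP.+-suc (s ℕ.* N) i)) N∣) (ℕ∣.n∣m*n s))
  last≃ : last ≃ mkℚᵘ (u (suc s)) s
  last≃ = *≡* (begin
    dilate N u (suc (s ℕ.* N ℕ.+ N₁)) ℤ.* + suc s
      ≡⟨ cong (λ k → dilate N u k ℤ.* + suc s) k≡ ⟩
    dilate N u (suc s ℕ.* N) ℤ.* + suc s
      ≡⟨ cong (λ b → (if b then + N ℤ.* u (suc s ℕ.* N ℕ./ N) else + 0) ℤ.* + suc s)
              (dec-true (N ∣? _) (ℕ∣.n∣m*n (suc s))) ⟩
    + N ℤ.* u (suc s ℕ.* N ℕ./ N) ℤ.* + suc s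
      ≡⟨ cong (λ k → + N ℤ.* u k ℤ.* + suc s) (m*n/n≡m (suc s) N) ⟩
    + N ℤ.* u (suc s) ℤ.* + suc s
      ≡⟨ solve 3 (λ n x s → n :* x :* s := x :* (s :* n)) refl (+ N) (u (suc s)) (+ suc s) ⟩
    u (suc s) ℤ.* (+ suc s ℤ.* + N)
      ≡⟨ cong (u (suc s) ℤ.*_) (sym (ℤP.pos-* (suc s) N)) ⟩
    u (suc s) ℤ.* + (suc s ℕ.* N)
      ≡⟨ cong (λ k → u (suc s) ℤ.* + k) (sym k≡) ⟩
    u (suc s) ℤ.* + suc (s ℕ.* N ℕ.+ N₁)
      ∎)
    where open ≡-Reasoning
          open +-*-Solver

-- Each term u m / m becomes the block N(m-1) < k ≤ N m, whose only nonzero term is N u m / (N m).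
harmonic-dilate : ∀ N .{{_ : NonZero N}} u s n → harmonic u s n ≃ harmonic (dilate N u) (s ℕ.* N) (n ℕ.* N)
harmonic-dilate N@(suc N₁) u s zero    = ≃-refl
harmonic-dilate N@(suc N₁) u s (suc n) = begin
  harmonic u s (suc n)
    ≈⟨ +-cong first rest ⟩
  harmonic (dilate N u) (s ℕ.* N) N + harmonic (dilate N u) (s ℕ.* N ℕ.+ N) (n ℕ.* N)
    ≈⟨ ≃-sym (harmonic-split (dilate N u) (s ℕ.* N) N (n ℕ.* N)) ⟩
  harmonic (dilate N u) (s ℕ.* N) (N ℕ.+ n ℕ.* N) ∎
  where
  open ≃-Reasoning
  first : mkℚᵘ (u (suc (s ℕ.+ 0))) (s ℕ.+ 0) ≃ harmonic (dilate N u) (s ℕ.* N) N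
  first = ≃-trans (≃-reflexive (cong (λ k → mkℚᵘ (u (suc k)) k) (ℕP.+-identityʳ s))) (≃-sym (dilate-block N₁ u s))
  rest : ∑ n (λ i → mkℚᵘ (u (suc (s ℕ.+ suc i))) (s ℕ.+ suc i)) ≃
         harmonic (dilate N u) (s ℕ.* N ℕ.+ N) (n ℕ.* N)
  rest = ≃-trans (∑-cong n (λ i _ → ≃-reflexive (cong (λ k → mkℚᵘ (u (suc k)) k) (ℕP.+-suc s i))))
         (≃-trans (harmonic-dilate N u (suc s) n)
                  (≃-reflexive (cong (λ a → harmonic (dilate N u) a (n ℕ.* N)) (ℕP.+-comm N (s ℕ.* N)))))

-- Congruences modulo p between p-integral rationals

module Congruence (p : ℕ) (p-prime : Prime p) where

  private instance
    p-nonTrivial : ℕ.NonTrivial p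
    p-nonTrivial = prime⇒nonTrivial p-prime

  0<m<p⇒p∤m : ∀ {m} → 0 < m → m < p → p ∤ m
  0<m<p⇒p∤m {suc _} _ m<p = ℕ∣.>⇒∤ m<p

  p∤1 : p ∤ 1
  p∤1 = 0<m<p⇒p∤m (s≤s z≤n) (ℕ.nonTrivial⇒n>1 p)

  p∤* : ∀ {m n} → p ∤ m → p ∤ n → p ∤ m ℕ.* n
  p∤* {m} {n} p∤m p∤n p∣mn with euclidsLemma m n p-prime p∣mn
  ... | inj₁ p∣m = p∤m p∣m
  ... | inj₂ p∣n = p∤n p∣n

  p∣-cancelʳ : ∀ x n → + p ℤ∣.∣ x ℤ.* + n → p ∤ n → + p ℤ∣.∣ x
  p∣-cancelʳ x n p∣xn p∤n with euclidsLemma ℤ.∣ x ∣ n p-prime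
                                 (subst (p ℕ∣.∣_) (ℤP.abs-* x (+ n)) (ℤ∣.∣⇒∣ᵤ p∣xn))
  ... | inj₁ p∣x = ℤ∣.∣ᵤ⇒∣ p∣x
  ... | inj₂ p∣n = contradiction p∣n p∤n

  -- x lies in the maximal ideal p ℤ₍ₚ₎ of the localisation of ℤ at p.
  record DivByP (x : ℚᵘ) : Set where
    constructor divByP
    field
      rep    : ℚᵘ
      x≃rep  : x ≃ rep
      p∣↥rep : + p ℤ∣.∣ ↥ rep
      p∤↧rep : p ∤ ↧ₙ rep

  DivByP-resp-≃ : ∀ {x y} → x ≃ y → DivByP x → DivByP y
  DivByP-resp-≃ x≃y (divByP r x≃r p∣ p∤) = divByP r (≃-trans (≃-sym x≃y) x≃r) p∣ p∤

  DivByP-0 : DivByP 0ℚᵘ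
  DivByP-0 = divByP 0ℚᵘ ≃-refl (ℤ∣.divides (+ 0) refl) p∤1

  DivByP-+ : ∀ {x y} → DivByP x → DivByP y → DivByP (x + y)
  DivByP-+ (divByP r@(mkℚᵘ _ _) x≃r p∣r p∤r) (divByP s@(mkℚᵘ _ _) y≃s p∣s p∤s) =
    divByP (r + s) (+-cong x≃r y≃s)
           (ℤ∣.∣m∣n⇒∣m+n (ℤ∣.∣m⇒∣m*n (↧ s) p∣r) (ℤ∣.∣m⇒∣m*n (↧ r) p∣s)) (p∤* p∤r p∤s)

  DivByP-neg : ∀ {x} → DivByP x → DivByP (- x)
  DivByP-neg (divByP (mkℚᵘ n d) x≃r p∣r p∤r) =
    divByP (mkℚᵘ (ℤ.- n) d) (-‿cong x≃r) (ℤ∣.∣m⇒∣-m p∣r) p∤r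

  DivByP-*ˡ : ∀ c {x} → DivByP x → DivByP (c / 1 * x)
  DivByP-*ˡ c (divByP r@(mkℚᵘ n d) x≃r p∣r p∤r) =
    divByP (c / 1 * r) (*-congˡ {c / 1} x≃r) (ℤ∣.∣n⇒∣m*n c p∣r)
           (subst (p ∤_) (sym (ℕP.+-identityʳ (suc d))) p∤r)

  DivByP-cancelˡ : ∀ c {x} → p ∤ suc c → DivByP (+ suc c / 1 * x) → DivByP x
  DivByP-cancelˡ c {mkℚᵘ n d} p∤c (divByP (mkℚᵘ m e) cx≃r p∣m p∤e) =
    divByP (mkℚᵘ m (e ℕ.+ c ℕ.* suc e)) (*≡* x≃r) p∣m (p∤* p∤c p∤e)
    where
    x≃r : n ℤ.* + (suc c ℕ.* suc e) ≡ m ℤ.* + suc d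
    x≃r = begin
      n ℤ.* + (suc c ℕ.* suc e)    ≡⟨ cong (n ℤ.*_) (ℤP.pos-* (suc c) (suc e)) ⟩
      n ℤ.* (+ suc c ℤ.* + suc e)  ≡⟨ solve 3 (λ n c e → n :* (c :* e) := (c :* n) :* e) refl n (+ suc c) (+ suc e) ⟩
      (+ suc c ℤ.* n) ℤ.* + suc e  ≡⟨ drop-*≡* cx≃r ⟩
      m ℤ.* + suc (d ℕ.+ 0)        ≡⟨ cong (λ k → m ℤ.* + suc k) (ℕP.+-identityʳ d) ⟩
      m ℤ.* + suc d                ∎
      where open ≡-Reasoning
            open +-*-Solver

  DivByP⇒p∣↥ : ∀ x → DivByP (toℚᵘ x) → + p ℤ∣ᵤ.∣ ℚ.↥ x
  DivByP⇒p∣↥ (ℚ.mkℚ n d _) (divByP (mkℚᵘ m e) x≃r p∣m p∤e) =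
    ℤ∣.∣⇒∣ᵤ (p∣-cancelʳ n (suc e) (subst (+ p ℤ∣.∣_) (sym (drop-*≡* x≃r)) (ℤ∣.∣m⇒∣m*n (+ suc d) p∣m))
                        p∤e)

  p∣↥⇒DivByP : ∀ x → + p ℤ∣ᵤ.∣ ℚ.↥ x → DivByP (toℚᵘ x)
  p∣↥⇒DivByP (ℚ.mkℚ n d coprime) p∣n = divByP (mkℚᵘ n d) ≃-refl (ℤ∣.∣ᵤ⇒∣ p∣n)
    (λ p∣d → ℕ.nonTrivial⇒≢1 (Coprimality.recompute coprime (p∣n , p∣d)))

  infix 4 _≈_

  record _≈_ (x y : ℚᵘ) : Set where
    constructor mk≈
    field
      x-y∈pℤₚ : DivByP (x - y)

  open _≈_

  ≃⇒≈ : ∀ {x y} → x ≃ y → x ≈ y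
  ≃⇒≈ {x} {y} x≃y = mk≈ $ DivByP-resp-≃ (≃-trans (≃-sym (+-inverseʳ x)) (+-congʳ x (-‿cong x≃y))) DivByP-0

  ≈-refl : ∀ {x} → x ≈ x
  ≈-refl = ≃⇒≈ ≃-refl

  ≈-sym : ∀ {x y} → x ≈ y → y ≈ x
  ≈-sym {x} {y} (mk≈ x≈y) =
    mk≈ $ DivByP-resp-≃ (solve 2 (λ x y → :- (x :- y) := y :- x) ≃-refl x y) (DivByP-neg x≈y)
    where open ℚᵘ-Solver.+-*-Solver

  ≈-trans : ∀ {x y z} → x ≈ y → y ≈ z → x ≈ z
  ≈-trans {x} {y} {z} (mk≈ x≈y) (mk≈ y≈z) = mk≈ $ DivByP-resp-≃ (+-minus-telescope x y z) (DivByP-+ x≈y y≈z)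

  ≈-isEquivalence : IsEquivalence _≈_
  ≈-isEquivalence = record { refl = ≈-refl ; sym = ≈-sym ; trans = ≈-trans }

  ≈-setoid : Setoid _ _
  ≈-setoid = record { isEquivalence = ≈-isEquivalence }

  module ≈-Reasoning = SetoidReasoning ≈-setoid

  +-cong-≈ : ∀ {x y u v} → x ≈ y → u ≈ v → x + u ≈ y + v
  +-cong-≈ {x} {y} {u} {v} (mk≈ x≈y) (mk≈ u≈v) =
    mk≈ $ DivByP-resp-≃ (solve 4 (λ x y u v → (x :- y) :+ (u :- v) := (x :+ u) :- (y :+ v)) ≃-refl x y u v)
                        (DivByP-+ x≈y u≈v)
    where open ℚᵘ-Solver.+-*-Solver

  *-congˡ-≈ : ∀ c {x y} → x ≈ y → c / 1 * x ≈ c / 1 * y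
  *-congˡ-≈ c {x} {y} (mk≈ x≈y) =
    mk≈ $ DivByP-resp-≃ (solve 3 (λ c x y → c :* (x :- y) := c :* x :- c :* y) ≃-refl (c / 1) x y)
                        (DivByP-*ˡ c x≈y)
    where open ℚᵘ-Solver.+-*-Solver

  *-cancelˡ-≈ : ∀ c {x y} → p ∤ suc c → + suc c / 1 * x ≈ + suc c / 1 * y → x ≈ y
  *-cancelˡ-≈ c {x} {y} p∤c (mk≈ cx≈cy) = mk≈ $ DivByP-cancelˡ c p∤c
    (DivByP-resp-≃ (solve 3 (λ c x y → c :* x :- c :* y := c :* (x :- y)) ≃-refl (+ suc c / 1) x y) cx≈cy)
    where open ℚᵘ-Solver.+-*-Solver

  ∑-cong-≈ : ∀ n {f g} → (∀ i → i < n → f i ≈ g i) → ∑ n f ≈ ∑ n g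
  ∑-cong-≈ zero    f≈g = ≈-refl
  ∑-cong-≈ (suc n) f≈g = +-cong-≈ (f≈g 0 (s≤s z≤n)) (∑-cong-≈ n (λ i i<n → f≈g (suc i) (s≤s i<n)))

  ≡[modℚ]⇔≈ : ∀ x y → x ≡ y [modℚ p ] ⇔ toℚᵘ x ≈ toℚᵘ y
  ≡[modℚ]⇔≈ x y = mk⇔ (mk≈ ∘ DivByP-resp-≃ toℚᵘ-homo-∸ ∘ p∣↥⇒DivByP (x ℚ.- y))
                       (DivByP⇒p∣↥ (x ℚ.- y) ∘ DivByP-resp-≃ (≃-sym toℚᵘ-homo-∸) ∘ x-y∈pℤₚ)
    where
    toℚᵘ-homo-∸ : toℚᵘ (x ℚ.- y) ≃ toℚᵘ x - toℚᵘ y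
    toℚᵘ-homo-∸ = ≃-trans (ℚP.toℚᵘ-homo-+ x (ℚ.- y)) (+-congʳ (toℚᵘ x) (ℚP.toℚᵘ-homo‿- y))

  /-shift : ∀ a t i → p ∤ suc i → mkℚᵘ a (t ℕ.* p ℕ.+ i) ≈ mkℚᵘ a i
  /-shift a t i p∤ = mk≈ (divByP _ ≃-refl
    (subst (+ p ℤ∣.∣_) (sym numerator≡) (ℤ∣.divides (ℤ.- (a ℤ.* + t)) refl)) (p∤* p∤tp+i p∤))
    where
    tp+1+i≡ : + suc (t ℕ.* p ℕ.+ i) ≡ + t ℤ.* + p ℤ.+ + suc i
    tp+1+i≡ = trans (cong +_ (sym (ℕP.+-suc (t ℕ.* p) i)))
                    (trans (ℤP.pos-+ (t ℕ.* p) (suc i)) (cong (ℤ._+ + suc i) (ℤP.pos-* t p)))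
    numerator≡ : a ℤ.* + suc i ℤ.+ (ℤ.- a) ℤ.* + suc (t ℕ.* p ℕ.+ i) ≡ (ℤ.- (a ℤ.* + t)) ℤ.* + p
    numerator≡ = trans (cong (λ z → a ℤ.* + suc i ℤ.+ (ℤ.- a) ℤ.* z) tp+1+i≡)
      (solve 4 (λ a t p s → a :* s :+ (:- a) :* (t :* p :+ s) := (:- (a :* t)) :* p) refl a (+ t) (+ p) (+ suc i))
      where open +-*-Solver
    p∤tp+i : p ∤ suc (t ℕ.* p ℕ.+ i)
    p∤tp+i p∣ = p∤ (ℕ∣.∣m+n∣m⇒∣n (subst (p ℕ∣.∣_) (sym (ℕP.+-suc (t ℕ.* p) i)) p∣) (ℕ∣.n∣m*n t))

  /-reflect : ∀ a i j → suc i ℕ.+ suc j ≡ p → mkℚᵘ a i + mkℚᵘ a j ≈ 0ℚᵘ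
  /-reflect a i j i+j≡p = mk≈ (DivByP-resp-≃ (≃-sym (+-identityʳ (mkℚᵘ a i + mkℚᵘ a j)))
      (divByP _ ≃-refl (subst (+ p ℤ∣.∣_) (sym numerator≡) (ℤ∣.divides a refl)) (p∤* p∤i p∤j)))
    where
    numerator≡ : a ℤ.* + suc j ℤ.+ a ℤ.* + suc i ≡ a ℤ.* + p
    numerator≡ = trans (sym (ℤP.*-distribˡ-+ a (+ suc j) (+ suc i)))
      (cong (a ℤ.*_) (trans (sym (ℤP.pos-+ (suc j) (suc i))) (cong +_ (trans (ℕP.+-comm (suc j) (suc i)) i+j≡p))))
    p∤i : p ∤ suc i
    p∤i = 0<m<p⇒p∤m (s≤s z≤n) (subst (suc i <_) i+j≡p (ℕP.m<m+n (suc i) (s≤s z≤n)))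
    p∤j : p ∤ suc j
    p∤j = 0<m<p⇒p∤m (s≤s z≤n) (subst (suc j <_) i+j≡p (ℕP.m<n+m (suc j) (s≤s z≤n)))

  harmonic-shift : ∀ w t n → n < p → harmonic w (t ℕ.* p) n ≈ harmonic (λ m → w (t ℕ.* p ℕ.+ m)) 0 n
  harmonic-shift w t n n<p = ∑-cong-≈ n (λ i i<n →
    subst (λ k → mkℚᵘ (w (suc (t ℕ.* p ℕ.+ i))) (t ℕ.* p ℕ.+ i) ≈ mkℚᵘ (w k) i)
          (sym (ℕP.+-suc (t ℕ.* p) i))
          (/-shift (w (suc (t ℕ.* p ℕ.+ i))) t i (0<m<p⇒p∤m (s≤s z≤n) (ℕP.≤-<-trans i<n n<p))))

  harmonic-reflect : ∀ X → harmonic (λ m → X m ℤ.+ X (p ∸ m)) 0 (p ∸ 1) ≈ 0ℚᵘ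
  harmonic-reflect X = begin
    harmonic (λ m → X m ℤ.+ X (p ∸ m)) 0 P₁
      ≈⟨ ≃⇒≈ (harmonic-+ X (λ m → X (p ∸ m)) 0 P₁) ⟩
    harmonic X 0 P₁ + harmonic (λ m → X (p ∸ m)) 0 P₁
      ≈⟨ ≃⇒≈ (+-congˡ (harmonic (λ m → X (p ∸ m)) 0 P₁) (≃-sym (∑-reverse P₁ _))) ⟩
    ∑ P₁ (λ i → mkℚᵘ (X (suc (P₁ ∸ suc i))) (P₁ ∸ suc i)) + ∑ P₁ (λ i → mkℚᵘ (X (p ∸ suc i)) i)
      ≈⟨ ≃⇒≈ (≃-sym (∑-distrib-+ P₁ _ _)) ⟩
    ∑ P₁ (λ i → mkℚᵘ (X (suc (P₁ ∸ suc i))) (P₁ ∸ suc i) + mkℚᵘ (X (p ∸ suc i)) i)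
      ≈⟨ ∑-cong-≈ P₁ pair≈0 ⟩
    ∑ P₁ (λ _ → 0ℚᵘ)
      ≈⟨ ≃⇒≈ (∑-zero P₁ (λ _ _ → ≃-refl)) ⟩
    0ℚᵘ ∎
    where
    open ≈-Reasoning
    P₁ = p ∸ 1
    p≡1+P₁ : p ≡ suc P₁
    p≡1+P₁ = sym (ℕP.suc-pred p {{ℕ.nonTrivial⇒nonZero p}})
    pair≈0 : ∀ i → i < P₁ →
             mkℚᵘ (X (suc (P₁ ∸ suc i))) (P₁ ∸ suc i) + mkℚᵘ (X (p ∸ suc i)) i ≈ 0ℚᵘ
    pair≈0 i i<P₁ = subst (λ k → mkℚᵘ (X k) (P₁ ∸ suc i) + mkℚᵘ (X (p ∸ suc i)) i ≈ 0ℚᵘ)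
      (sym (trans (sym (ℕP.+-∸-assoc 1 i<P₁)) (cong (_∸ suc i) (sym p≡1+P₁))))
      (/-reflect (X (p ∸ suc i)) (P₁ ∸ suc i) i (trans (cong suc (ℕP.m∸n+n≡m i<P₁)) (sym p≡1+P₁)))

-- Relations between partial harmonic sums modulo p

𝟙 : ∀ {ℓ} {A : Set ℓ} → Dec A → ℤ
𝟙 a? = if does a? then + 1 else + 0

𝟙-cong : ∀ {a b} {A : Set a} {B : Set b} (a? : Dec A) (b? : Dec B) → A ⇔ B → 𝟙 a? ≡ 𝟙 b?
𝟙-cong (yes a) b? A⇔B = sym (cong (λ x → if x then + 1 else + 0) (dec-true b? (Equivalence.to A⇔B a)))
𝟙-cong (no ¬a) b? A⇔B = sym (cong (λ x → if x then + 1 else + 0) (dec-false b? (¬a ∘ Equivalence.from A⇔B)))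

module Relations (p : ℕ) (p-prime : Prime p) where
  open Congruence p p-prime

  private instance
    p-nonZero : NonZero p
    p-nonZero = ℕ.nonTrivial⇒nonZero p {{prime⇒nonTrivial p-prime}}

  H : (ℕ → ℤ) → ℚᵘ
  H w = harmonic w 0 (p ∸ 1)

  p≡1+[p∸1] : p ≡ suc (p ∸ 1)
  p≡1+[p∸1] = sym (ℕP.suc-pred p)

  InWindow : ℕ → ℕ → Set
  InWindow t k = t ℕ.* p < k × k < suc t ℕ.* p

  p∸1<p : p ∸ 1 < p
  p∸1<p = subst (p ∸ 1 <_) (sym p≡1+[p∸1]) (ℕP.n<1+n (p ∸ 1))

  window : ∀ t k → Dec (InWindow t k)
  window t k = (t ℕ.* p <? k) ×-dec (k <? suc t ℕ.* p)

  interval : ℕ → ℕ → ℕ → ℤ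
  interval N t m = 𝟙 (window t (N ℕ.* m))

  progression : ℕ → ℕ → ℕ → ℤ
  progression N t m = + N ℤ.* 𝟙 (N ∣? m ℕ.+ t ℕ.* p)

  interval-outside : ∀ N t m → ¬ InWindow t (N ℕ.* m) → interval N t m ≡ + 0
  interval-outside N t m ∉ = cong (λ b → if b then + 1 else + 0) (dec-false (window t (N ℕ.* m)) ∉)

  interval-inside : ∀ N t m → InWindow t (N ℕ.* m) → interval N t m ≡ + 1
  interval-inside N t m ∈ = cong (λ b → if b then + 1 else + 0) (dec-true (window t (N ℕ.* m)) ∈)

  module _ (N : ℕ) .{{_ : NonZero N}} (t : ℕ) where

    dilate-interval : ∀ k → dilate N (interval N t) k ≡ (if does (N ∣? k) then + N ℤ.* 𝟙 (window t k) else + 0)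
    dilate-interval k with N ∣? k
    ... | yes N∣k = cong (λ l → + N ℤ.* 𝟙 (window t l)) (m*[n/m]≡n N∣k)
    ... | no  _   = refl

    dilate-interval-outside : ∀ k → ¬ InWindow t k → dilate N (interval N t) k ≡ + 0
    dilate-interval-outside k ∉window with does (N ∣? k) | dilate-interval k
    ... | false | eq = eq
    ... | true  | eq = trans eq (trans (cong (λ b → + N ℤ.* (if b then + 1 else + 0)) (dec-false (window t k) ∉window))
                                       (ℤP.*-zeroʳ (+ N)))

    dilate-interval-inside : ∀ m → 0 < m → m < p → dilate N (interval N t) (t ℕ.* p ℕ.+ m) ≡ progression N t m
    dilate-interval-inside m 0<m m<p = begin
      dilate N (interval N t) (t ℕ.* p ℕ.+ m)
        ≡⟨ dilate-interval (t ℕ.* p ℕ.+ m) ⟩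
      (if does (N ∣? t ℕ.* p ℕ.+ m) then + N ℤ.* 𝟙 (window t (t ℕ.* p ℕ.+ m)) else + 0)
        ≡⟨ cong (λ b → if does (N ∣? t ℕ.* p ℕ.+ m) then + N ℤ.* (if b then + 1 else + 0) else + 0)
                (dec-true (window t _) (ℕP.m<m+n (t ℕ.* p) 0<m , tp+m<p+tp)) ⟩
      (if does (N ∣? t ℕ.* p ℕ.+ m) then + N ℤ.* + 1 else + 0)
        ≡⟨ if-*-𝟙 (does (N ∣? t ℕ.* p ℕ.+ m)) ⟩
      + N ℤ.* 𝟙 (N ∣? t ℕ.* p ℕ.+ m)
        ≡⟨ cong (λ k → + N ℤ.* 𝟙 (N ∣? k)) (ℕP.+-comm (t ℕ.* p) m) ⟩
      progression N t m ∎
      where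
      open ≡-Reasoning
      if-*-𝟙 : ∀ b → (if b then + N ℤ.* + 1 else + 0) ≡ + N ℤ.* (if b then + 1 else + 0)
      if-*-𝟙 true  = refl
      if-*-𝟙 false = sym (ℤP.*-zeroʳ (+ N))
      tp+m<p+tp : t ℕ.* p ℕ.+ m < p ℕ.+ t ℕ.* p
      tp+m<p+tp = subst (t ℕ.* p ℕ.+ m <_) (ℕP.+-comm (t ℕ.* p) p) (ℕP.+-monoʳ-< (t ℕ.* p) m<p)

  harmonic-dropLastₚ : ∀ w a → w (a ℕ.+ p) ≡ + 0 → harmonic w a p ≃ harmonic w a (p ∸ 1)
  harmonic-dropLastₚ w a w≡0 = subst (λ n → harmonic w a n ≃ harmonic w a (p ∸ 1)) (sym p≡1+[p∸1])
    (harmonic-dropLast w a (p ∸ 1) (trans (cong w a+1+[p∸1]≡a+p) w≡0))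
    where
    a+1+[p∸1]≡a+p : suc (a ℕ.+ (p ∸ 1)) ≡ a ℕ.+ p
    a+1+[p∸1]≡a+p = trans (sym (ℕP.+-suc a (p ∸ 1))) (cong (a ℕ.+_) (sym p≡1+[p∸1]))

  -- The classical relation ∑_{tp/N < m < (t+1)p/N} 1/m ≡ N ∑_{m ≡ -tp (mod N)} 1/m: write the left side as a
  -- sum over k = N m ∈ (tp, (t+1)p) and replace 1/k by 1/(k - tp).
  interval≈progression : ∀ N .{{_ : NonZero N}} t → t < N → H (interval N t) ≈ H (progression N t)
  interval≈progression N t t<N = begin
    H (interval N t)
      ≈⟨ ≃⇒≈ (≃-sym (harmonic-dropLastₚ (interval N t) 0 interval-at-p)) ⟩
    harmonic (interval N t) 0 p
      ≈⟨ ≃⇒≈ (harmonic-dilate N (interval N t) 0 p) ⟩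
    harmonic D 0 (p ℕ.* N)
      ≈⟨ ≃⇒≈ (≃-trans (≃-reflexive (cong (harmonic D 0) pN≡)) restrict) ⟩
    harmonic D (t ℕ.* p) p
      ≈⟨ ≃⇒≈ (harmonic-dropLastₚ D (t ℕ.* p) (dilate-interval-outside N t (t ℕ.* p ℕ.+ p)
                (λ (_ , k<) → ℕP.<-irrefl (ℕP.+-comm (t ℕ.* p) p) k<))) ⟩
    harmonic D (t ℕ.* p) (p ∸ 1)
      ≈⟨ harmonic-shift D t (p ∸ 1) p∸1<p ⟩
    harmonic (λ m → D (t ℕ.* p ℕ.+ m)) 0 (p ∸ 1)
      ≈⟨ ≃⇒≈ (harmonic-cong {λ m → D (t ℕ.* p ℕ.+ m)} {progression N t} 0 (p ∸ 1) (λ i i<p-1 →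
                dilate-interval-inside N t (suc i) (s≤s z≤n) (subst (suc i <_) (sym p≡1+[p∸1]) (s≤s i<p-1)))) ⟩
    H (progression N t) ∎
    where
    open ≈-Reasoning
    D = dilate N (interval N t)
    r = N ∸ suc t
    interval-at-p : interval N t (0 ℕ.+ p) ≡ + 0
    interval-at-p = interval-outside N t p (λ (_ , Np<) → ℕP.<⇒≱ Np< (ℕP.*-monoˡ-≤ p t<N))
    pN≡ : p ℕ.* N ≡ t ℕ.* p ℕ.+ (p ℕ.+ r ℕ.* p)
    pN≡ = trans (ℕP.*-comm p N) (trans (cong (ℕ._* p) (sym (trans (ℕP.+-suc t r) (ℕP.m+[n∸m]≡n t<N))))
                                       (ℕP.*-distribʳ-+ p t (suc r)))
    restrict : harmonic D 0 (t ℕ.* p ℕ.+ (p ℕ.+ r ℕ.* p)) ≃ harmonic D (t ℕ.* p) p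
    restrict = harmonic-restrict D (t ℕ.* p) p (r ℕ.* p)
      (λ i i<tp → dilate-interval-outside N t (suc i) (λ (tp< , _) → ℕP.<⇒≱ tp< i<tp))
      (λ i _ → dilate-interval-outside N t _ (λ (_ , k<) → ℕP.<⇒≱ k<
        (ℕP.≤-trans (ℕP.≤-reflexive (ℕP.+-comm p (t ℕ.* p))) (ℕP.≤-trans (ℕP.m≤m+n _ i) (ℕP.n≤1+n _)))))

  relation : ℕ → ℕ → ℕ → ℤ
  relation N t m = interval N t m ℤ.- progression N t m

  Null : (ℕ → ℤ) → Set
  Null w = H w ≈ 0ℚᵘ

  Null-+ : ∀ {v w} → Null v → Null w → Null (λ m → v m ℤ.+ w m)
  Null-+ {v} {w} v≈0 w≈0 =
    ≈-trans (≃⇒≈ (harmonic-+ v w 0 (p ∸ 1))) (≈-trans (+-cong-≈ v≈0 w≈0) (≃⇒≈ (+-identityʳ 0ℚᵘ)))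

  Null-*ˡ : ∀ c {w} → Null w → Null (λ m → c ℤ.* w m)
  Null-*ˡ c {w} w≈0 =
    ≈-trans (≃⇒≈ (harmonic-*ˡ c w 0 (p ∸ 1))) (≈-trans (*-congˡ-≈ c w≈0) (≃⇒≈ (*-zeroʳ (c / 1))))

  Null-relation : ∀ N .{{_ : NonZero N}} t → t < N → Null (relation N t)
  Null-relation N t t<N = begin
    H (relation N t)
      ≈⟨ ≃⇒≈ (≃-trans (harmonic-+ (interval N t) (λ m → ℤ.- progression N t m) 0 (p ∸ 1))
                      (+-congʳ (H (interval N t)) (harmonic-neg (progression N t) 0 (p ∸ 1)))) ⟩
    H (interval N t) - H (progression N t)
      ≈⟨ +-cong-≈ (interval≈progression N t t<N) ≈-refl ⟩
    H (progression N t) - H (progression N t)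
      ≈⟨ ≃⇒≈ (+-inverseʳ (H (progression N t))) ⟩
    0ℚᵘ ∎
    where open ≈-Reasoning

  Null-mirror : ∀ X → Null (λ m → X m ℤ.+ X (p ∸ m))
  Null-mirror = harmonic-reflect

-- Floor division and residues

<[1+/]* : ∀ x d .{{_ : NonZero d}} → x < suc (x ℕ./ d) ℕ.* d
<[1+/]* x d = begin-strict
  x                          ≡⟨ m≡m%n+[m/n]*n x d ⟩
  x % d ℕ.+ (x ℕ./ d) ℕ.* d  <⟨ ℕP.+-monoˡ-< ((x ℕ./ d) ℕ.* d) (m%n<n x d) ⟩
  d ℕ.+ (x ℕ./ d) ℕ.* d      ∎
  where open ℕP.≤-Reasoning

≤/⇔*≤ : ∀ {k} x d .{{_ : NonZero d}} → k ≤ x ℕ./ d ⇔ k ℕ.* d ≤ x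
≤/⇔*≤ {k} x d = mk⇔ (λ k≤x/d → ℕP.≤-trans (ℕP.*-monoˡ-≤ d k≤x/d) (m/n*n≤m x d))
                    (λ kd≤x → ℕP.≮⇒≥ (λ x/d<k → ℕP.<-irrefl refl
                      (ℕP.<-≤-trans (<[1+/]* x d) (ℕP.≤-trans (ℕP.*-monoˡ-≤ d x/d<k) kd≤x))))

/<⇔<* : ∀ {k} x d .{{_ : NonZero d}} → x ℕ./ d < k ⇔ x < k ℕ.* d
/<⇔<* {k} x d = mk⇔ (λ x/d<k → ℕP.<-≤-trans (<[1+/]* x d) (ℕP.*-monoˡ-≤ d x/d<k))
                    (m<n*o⇒m/o<n {x} {k} {d})

≡⇒⇔ : ∀ {ℓ} {A B : Set ℓ} → A ≡ B → A ⇔ B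
≡⇒⇔ refl = mk⇔ (λ a → a) (λ a → a)

%≡⇒∣⇔ : ∀ {x y} d .{{_ : NonZero d}} → x % d ≡ y % d → d ∣ x ⇔ d ∣ y
%≡⇒∣⇔ {x} {y} d x≡y = mk⇔ (λ d∣x → m%n≡0⇒n∣m y d (trans (sym x≡y) (n∣m⇒m%n≡0 x d d∣x)))
                          (λ d∣y → m%n≡0⇒n∣m x d (trans x≡y (n∣m⇒m%n≡0 y d d∣y)))

%ℕ-spec : ∀ i d .{{_ : NonZero d}} → + d ℤ∣.∣ i ℤ.- + (i %ℕ d)
%ℕ-spec i d = ℤ∣.divides (i /ℕ d) (begin
  i ℤ.- + (i %ℕ d)
    ≡⟨ cong (ℤ._- + (i %ℕ d)) (a≡a%ℕn+[a/ℕn]*n i d) ⟩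
  + (i %ℕ d) ℤ.+ (i /ℕ d) ℤ.* + d ℤ.- + (i %ℕ d)
    ≡⟨ solve 2 (λ r x → r :+ x :- r := x) refl (+ (i %ℕ d)) ((i /ℕ d) ℤ.* + d) ⟩
  (i /ℕ d) ℤ.* + d
    ∎)
  where open ≡-Reasoning
        open +-*-Solver

∣∧<⇒≡0 : ∀ {d x} → d ℕ∣.∣ x → x < d → x ≡ 0
∣∧<⇒≡0 {x = zero}  _   _   = refl
∣∧<⇒≡0 {x = suc _} d∣x x<d = contradiction (ℕ∣.∣⇒≤ d∣x) (ℕP.<⇒≱ x<d)

∣-diff⇒≡-ordered : ∀ {a b d} → b ≤ a → a < d → + d ℤ∣.∣ + a ℤ.- + b → a ≡ b
∣-diff⇒≡-ordered {a} {b} {d} b≤a a<d d∣a-b =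
  ℕP.≤-antisym (ℕP.m∸n≡0⇒m≤n (∣∧<⇒≡0 d∣a∸b (ℕP.≤-<-trans (ℕP.m∸n≤m a b) a<d))) b≤a
  where
  d∣a∸b : d ℕ∣.∣ a ℕ.∸ b
  d∣a∸b = subst (d ℕ∣.∣_) (cong ℤ.∣_∣ (trans (ℤP.[+m]-[+n]≡m⊖n a b) (ℤP.⊖-≥ b≤a))) (ℤ∣.∣⇒∣ᵤ d∣a-b)

∣-diff⇒≡ : ∀ {a b d} → a < d → b < d → + d ℤ∣.∣ + a ℤ.- + b → a ≡ b
∣-diff⇒≡ {a} {b} a<d b<d d∣a-b with ℕP.≤-total b a
... | inj₁ b≤a = ∣-diff⇒≡-ordered b≤a a<d d∣a-b
... | inj₂ a≤b = sym (∣-diff⇒≡-ordered a≤b b<d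
  (subst (_ ℤ∣.∣_) (solve 2 (λ a b → :- (a :- b) := b :- a) refl (+ a) (+ b)) (ℤ∣.∣m⇒∣-m d∣a-b)))
  where open +-*-Solver

%ℕ-cong : ∀ {d k} .{{_ : NonZero d}} → d ℕ∣.∣ k → ∀ i j → + k ℤ∣.∣ i ℤ.- j → i %ℕ d ≡ j %ℕ d
%ℕ-cong {d} {k} d∣k i j k∣i-j = ∣-diff⇒≡ (n%ℕd<d i d) (n%ℕd<d j d) (subst (+ d ℤ∣.∣_) eq
  (ℤ∣.∣m∣n⇒∣m+n (ℤ∣.∣m∣n⇒∣m-n (ℤ∣.∣-trans (ℤ∣.∣ᵤ⇒∣ d∣k) k∣i-j) (%ℕ-spec i d)) (%ℕ-spec j d)))
  where
  eq : i ℤ.- j ℤ.- (i ℤ.- + (i %ℕ d)) ℤ.+ (j ℤ.- + (j %ℕ d)) ≡ + (i %ℕ d) ℤ.- + (j %ℕ d)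
  eq = solve 4 (λ i j r s → i :- j :- (i :- r) :+ (j :- s) := r :- s) refl i j (+ (i %ℕ d)) (+ (j %ℕ d))
    where open +-*-Solver

inClass-cong : ∀ {p q i j} → p % 5 ≡ q % 5 → i %ℕ 10 ≡ j %ℕ 10 → inClass p i ≡ inClass q j
inClass-cong {p} {q} e f with p % 5 | q % 5 | e
... | 0 | _ | refl = cong (λ r → (r ≡ᵇ 1) ∨ (r ≡ᵇ 5)) f
... | 1 | _ | refl = cong (λ r → (r ≡ᵇ 5) ∨ (r ≡ᵇ 7)) f
... | 2 | _ | refl = cong (λ r → (r ≡ᵇ 1) ∨ (r ≡ᵇ 5)) f
... | 3 | _ | refl = cong (λ r → (r ≡ᵇ 1) ∨ (r ≡ᵇ 5)) f
... | 4 | _ | refl = cong (λ r → (r ≡ᵇ 5) ∨ (r ≡ᵇ 7)) f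
... | suc (suc (suc (suc (suc _)))) | _ | refl = cong (λ r → (r ≡ᵇ 1) ∨ (r ≡ᵇ 5)) f

leg5-cong : ∀ {i j} → i %ℕ 5 ≡ j %ℕ 5 → leg5 i ≡ leg5 j
leg5-cong {i} {j} e with i %ℕ 5 | j %ℕ 5 | e
... | 0 | _ | refl = refl
... | 1 | _ | refl = refl
... | 2 | _ | refl = refl
... | 3 | _ | refl = refl
... | 4 | _ | refl = refl
... | suc (suc (suc (suc (suc _)))) | _ | refl = refl

legM1-cong : ∀ {i j} → i %ℕ 4 ≡ j %ℕ 4 → legM1 i ≡ legM1 j
legM1-cong {i} {j} e with i %ℕ 4 | j %ℕ 4 | e
... | 0 | _ | refl = refl
... | 1 | _ | refl = refl
... | suc (suc _) | _ | refl = refl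

coeffA : ℕ → ℤ → ℤ
coeffA p j = if inClass p j then leg5 (j ℤ.+ + 1) ℤ.* legM1 j else + 0

coeffA-cong : ∀ {p q i j} → p % 5 ≡ q % 5 → + 20 ℤ∣.∣ i ℤ.- j → coeffA p i ≡ coeffA q j
coeffA-cong {p} {q} {i} {j} p≡q 20∣i-j = cong₂ (λ b v → if b then v else + 0)
  (inClass-cong {p} {q} {i} {j} p≡q (%ℕ-cong {10} (divides 2 refl) i j 20∣i-j))
  (cong₂ ℤ._*_ (leg5-cong {i ℤ.+ + 1} {j ℤ.+ + 1} (%ℕ-cong {5} (divides 4 refl) (i ℤ.+ + 1) (j ℤ.+ + 1)
                                                           (subst (+ 20 ℤ∣.∣_) (shift-1 i j) 20∣i-j)))
               (legM1-cong {i} {j} (%ℕ-cong {4} (divides 5 refl) i j 20∣i-j)))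
  where
  shift-1 : ∀ i j → i ℤ.- j ≡ i ℤ.+ + 1 ℤ.- (j ℤ.+ + 1)
  shift-1 = solve 2 (λ i j → i :- j := i :+ con (+ 1) :- (j :+ con (+ 1))) refl
    where open +-*-Solver

coeffA-0 : ∀ p → coeffA p (+ 0) ≡ + 0
coeffA-0 p with p % 5
... | 0 = refl
... | 1 = refl
... | 2 = refl
... | 3 = refl
... | 4 = refl
... | suc (suc (suc (suc (suc _)))) = refl

data Modulus : Set where
  ten twenty : Modulus

modulus : Modulus → ℕ
modulus ten    = 10
modulus twenty = 20

cofactor : Modulus → ℕ
cofactor ten    = 2
cofactor twenty = 1

cofactor*modulus : ∀ M → cofactor M ℕ.* modulus M ≡ 20
cofactor*modulus ten    = refl
cofactor*modulus twenty = refl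

modulus∣20 : ∀ M → modulus M ∣ 20
modulus∣20 M = divides (cofactor M) (sym (cofactor*modulus M))

cofactor-nonZero : ∀ M → NonZero (cofactor M)
cofactor-nonZero ten    = _
cofactor-nonZero twenty = _

modulus-nonZero : ∀ M → NonZero (modulus M)
modulus-nonZero ten    = _
modulus-nonZero twenty = _

infix 6 _·⟨_,_⟩

record Entry : Set where
  constructor _·⟨_,_⟩
  field
    coeff : ℤ
    mod   : Modulus
    part  : ℕ

Valid : Entry → Set
Valid (_ ·⟨ M , t ⟩) = t < modulus M

record Certificate : Set where
  field
    relations : List Entry
    mirror    : List (ℕ × ℤ)

infix 4 _↦_

_↦_ : List ℕ → ℤ → List (ℕ × ℤ)
rs ↦ v = map (_, v) rs

relations-1 : List Entry
relations-1 =
  -1ℤ ·⟨ ten , 2 ⟩ ∷ -1ℤ ·⟨ ten , 3 ⟩ ∷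
  -1ℤ ·⟨ twenty , 4 ⟩ ∷ -1ℤ ·⟨ twenty , 5 ⟩ ∷ -1ℤ ·⟨ twenty , 6 ⟩ ∷ -1ℤ ·⟨ twenty , 7 ⟩ ∷ []

relations-3 : List Entry
relations-3 =
  1ℤ ·⟨ ten , 0 ⟩ ∷ 1ℤ ·⟨ ten , 1 ⟩ ∷ 1ℤ ·⟨ ten , 4 ⟩ ∷ 1ℤ ·⟨ ten , 5 ⟩ ∷
  1ℤ ·⟨ ten , 6 ⟩ ∷ 1ℤ ·⟨ ten , 7 ⟩ ∷ 1ℤ ·⟨ ten , 8 ⟩ ∷ 1ℤ ·⟨ ten , 9 ⟩ ∷
  -1ℤ ·⟨ twenty , 4 ⟩ ∷ -1ℤ ·⟨ twenty , 5 ⟩ ∷ -1ℤ ·⟨ twenty , 6 ⟩ ∷ -1ℤ ·⟨ twenty , 7 ⟩ ∷ []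

relations-7 : List Entry
relations-7 =
  -1ℤ ·⟨ ten , 2 ⟩ ∷ ℤ.- + 2 ·⟨ ten , 3 ⟩ ∷ -1ℤ ·⟨ ten , 6 ⟩ ∷
  -1ℤ ·⟨ twenty , 4 ⟩ ∷ -1ℤ ·⟨ twenty , 5 ⟩ ∷ 1ℤ ·⟨ twenty , 12 ⟩ ∷ 1ℤ ·⟨ twenty , 13 ⟩ ∷ []

certificate : ℕ → Certificate
certificate 1  = record { relations = relations-1 ; mirror = 3 ∷ 4 ∷ 5 ∷ 6 ∷ 7 ∷ 8 ∷ [] ↦ ℤ.- + 10 }
certificate 3  = record { relations = relations-3
                        ; mirror    = (0 ∷ 6 ∷ 10 ∷ 16 ∷ [] ↦ + 9) ++
                                      (2 ∷ 4 ∷ 5 ∷ 11 ∷ 14 ∷ 15 ∷ [] ↦ -1ℤ) }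
certificate 7  = record { relations = relations-7 ; mirror = 2 ∷ 9 ∷ 15 ∷ 19 ∷ [] ↦ ℤ.- + 10 }
certificate 9  = record { relations = relations-7 ; mirror = 3 ∷ 5 ∷ 13 ∷ 14 ∷ [] ↦ ℤ.- + 10 }
certificate 11 = record { relations = relations-1 ; mirror = 3 ∷ 5 ∷ 7 ∷ 13 ∷ 14 ∷ 15 ∷ [] ↦ ℤ.- + 10 }
certificate 13 = record { relations = relations-1 ; mirror = 4 ∷ 5 ∷ 11 ∷ 12 ∷ 14 ∷ 15 ∷ [] ↦ ℤ.- + 10 }
certificate 17 = record { relations = relations-7 ; mirror = 5 ∷ 9 ∷ 15 ∷ 19 ∷ [] ↦ ℤ.- + 10 }
certificate 19 = record { relations = relations-7 ; mirror = 13 ∷ 14 ∷ 15 ∷ 16 ∷ [] ↦ ℤ.- + 10 }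
certificate _  = record { relations = [] ; mirror = [] }

-- The weights of the proof as functions of q = p mod 20, r = m mod 20 and s = ⌊20 m / p⌋; the *-profile lemmas
-- below show that for 0 < m < p the actual weights are these.
lookupOr0 : List (ℕ × ℤ) → ℕ → ℤ
lookupOr0 []              r = + 0
lookupOr0 ((k , v) ∷ kvs) r = if k ≡ᵇ r then v else lookupOr0 kvs r

intervalAt : ℕ → ℕ → ℕ → ℤ
intervalAt c t s = 𝟙 ((c ℕ.* t ≤? s) ×-dec (s <? c ℕ.* suc t))

relationAt : Modulus → ℕ → ℕ → ℕ → ℕ → ℤ
relationAt M t q r s = intervalAt (cofactor M) t s ℤ.- + modulus M ℤ.* 𝟙 (modulus M ∣? r ℕ.+ t ℕ.* q)

combinationAt : List Entry → ℕ → ℕ → ℕ → ℤ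
combinationAt []                  q r s = + 0
combinationAt (μ ·⟨ M , t ⟩ ∷ es) q r s = μ ℤ.* relationAt M t q r s ℤ.+ combinationAt es q r s

lhsAt : ℕ → ℕ → ℤ
lhsAt q r = (+ 5 ℤ.* (+ 2 ℤ.* legM1 (+ q))) ℤ.* (coeffA q (+ q ℤ.- + r) ℤ.+ coeffA q (ℤ.- + r))

rhsAt : ℕ → ℕ → ℕ → ℤ
rhsAt q r s = + 2 ℤ.* intervalAt 4 1 s ℤ.+
              (combinationAt relations q r s ℤ.+ (lookupOr0 mirror r ℤ.+ lookupOr0 mirror ((+ q ℤ.- + r) %ℕ 20)))
  where open Certificate (certificate q)

Checks : ℕ → Set
Checks q = All Valid (Certificate.relations (certificate q)) ×
           (∀ (r s : Fin 20) → lhsAt q (toℕ r) ≡ rhsAt q (toℕ r) (toℕ s))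

checks? : Decidable Checks
checks? q = All.all? (λ (_ ·⟨ M , t ⟩) → t <? modulus M) _ ×-dec
            Fin.all? (λ r → Fin.all? (λ s → lhsAt q (toℕ r) ℤ.≟ rhsAt q (toℕ r) (toℕ s)))

-- Opaque, so that uses at an open index do not re-run the decision procedure.
opaque
  certificate-checks : ∀ (q : Fin 20) → 2 ∣ toℕ q ⊎ 5 ∣ toℕ q ⊎ Checks (toℕ q)
  certificate-checks = toWitness {a? = Fin.all? (λ q → 2 ∣? toℕ q ⊎-dec 5 ∣? toℕ q ⊎-dec checks? (toℕ q))} _

toℚᵘ-frac : ∀ n d → toℚᵘ (frac n (suc d)) ≃ mkℚᵘ n d
toℚᵘ-frac n d = ℚP.toℚᵘ-fromℚᵘ (mkℚᵘ n d)

toℚᵘ-sumℚ : ∀ f n → toℚᵘ (sumℚ (applyUpTo f n)) ≃ ∑ n (toℚᵘ ∘ f)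
toℚᵘ-sumℚ f zero    = ≃-refl
toℚᵘ-sumℚ f (suc n) = ≃-trans (ℚP.toℚᵘ-homo-+ (f 0) (sumℚ (applyUpTo (f ∘ suc) n)))
                              (+-congʳ (toℚᵘ (f 0)) (toℚᵘ-sumℚ (f ∘ suc) n))

toℚᵘ-sumℚ-map : ∀ {A : Set} (g : A → ℚ) φ n → toℚᵘ (sumℚ (map g (map φ (upTo n)))) ≃ ∑ n (λ i → toℚᵘ (g (φ i)))
toℚᵘ-sumℚ-map g φ n = ≃-trans
  (≃-reflexive (cong (toℚᵘ ∘ sumℚ) (trans (cong (map g) (map-applyUpTo (λ i → i) φ n)) (map-applyUpTo φ g n))))
  (toℚᵘ-sumℚ (g ∘ φ) n)

module Theorem (p : ℕ) (p-prime : Prime p) (5<p : 5 < p) where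
  open Congruence p p-prime
  open Relations p p-prime

  private instance
    p-nonZero : NonZero p
    p-nonZero = ℕ.>-nonZero (ℕP.<-trans (s≤s z≤n) 5<p)

  p∤5 : p ∤ 5
  p∤5 = ℕ∣.>⇒∤ 5<p

  a₅ b₅ : ℕ
  a₅ = p ℕ./ 5
  b₅ = (2 ℕ.* p) ℕ./ 5

  W≃harmonic : toℚᵘ (W p) ≃ mkℚᵘ (+ 2) 4 * harmonic (λ _ → + 1) a₅ (b₅ ∸ a₅)
  W≃harmonic = ≃-trans (ℚP.toℚᵘ-homo-* (frac (+ 2) 5) (sumℚ (map (frac (+ 1)) (natRange (suc a₅) b₅))))
    (*-cong (toℚᵘ-frac (+ 2) 4) (≃-trans (toℚᵘ-sumℚ-map (frac (+ 1)) (suc a₅ ℕ.+_) (b₅ ∸ a₅))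
                                          (∑-cong (b₅ ∸ a₅) (λ i _ → toℚᵘ-frac (+ 1) (a₅ ℕ.+ i)))))

  H-interval-5-1 : H (interval 5 1) ≃ harmonic (λ _ → + 1) a₅ (b₅ ∸ a₅)
  H-interval-5-1 = begin
    H (interval 5 1)                                ≡⟨ cong (harmonic (interval 5 1) 0) p∸1≡a+[L+R] ⟩
    harmonic (interval 5 1) 0 (a₅ ℕ.+ (L ℕ.+ R))    ≈⟨ harmonic-restrict (interval 5 1) a₅ L R below above ⟩
    harmonic (interval 5 1) a₅ L                    ≈⟨ harmonic-cong {interval 5 1} {λ _ → + 1} a₅ L middle ⟩
    harmonic (λ _ → + 1) a₅ L                       ∎
    where
    open ≃-Reasoning
    L = b₅ ∸ a₅
    R = p ∸ 1 ∸ b₅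
    a≤b : a₅ ≤ b₅
    a≤b = /-monoˡ-≤ 5 (ℕP.m≤m+n p (p ℕ.+ 0))
    b<p : b₅ < p
    b<p = m<n*o⇒m/o<n (subst (2 ℕ.* p <_) (ℕP.*-comm 5 p) (ℕP.*-monoˡ-< p {2} {5} (s≤s (s≤s (s≤s z≤n)))))
    a+L≡b : a₅ ℕ.+ L ≡ b₅
    a+L≡b = ℕP.m+[n∸m]≡n a≤b
    p∸1≡a+[L+R] : p ∸ 1 ≡ a₅ ℕ.+ (L ℕ.+ R)
    p∸1≡a+[L+R] = sym (trans (sym (ℕP.+-assoc a₅ L R))
      (trans (cong (ℕ._+ R) a+L≡b) (ℕP.m+[n∸m]≡n (ℕP.≤-pred (subst (suc b₅ ≤_) p≡1+[p∸1] b<p)))))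
    5*≡*5 : ∀ m → 5 ℕ.* m ≡ m ℕ.* 5
    5*≡*5 m = ℕP.*-comm 5 m
    below : ∀ i → i < a₅ → interval 5 1 (suc i) ≡ + 0
    below i i<a = interval-outside 5 1 (suc i) (λ (p< , _) → ℕP.<⇒≱ p<
      (subst₂ _≤_ (sym (5*≡*5 (suc i))) (sym (ℕP.*-identityˡ p)) (Equivalence.to (≤/⇔*≤ p 5) i<a)))
    middle : ∀ i → i < L → interval 5 1 (suc (a₅ ℕ.+ i)) ≡ + 1
    middle i i<L = interval-inside 5 1 m
      ( subst₂ _<_ (sym (ℕP.*-identityˡ p)) (sym (5*≡*5 m)) (Equivalence.to (/<⇔<* p 5) (s≤s (ℕP.m≤m+n a₅ i)))
      , ℕP.≤∧≢⇒< (subst (_≤ 2 ℕ.* p) (sym (5*≡*5 m)) (Equivalence.to (≤/⇔*≤ (2 ℕ.* p) 5) m≤b)) 5m≢2p)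
      where
      m = suc (a₅ ℕ.+ i)
      m≤b : m ≤ b₅
      m≤b = subst₂ _≤_ (ℕP.+-suc a₅ i) a+L≡b (ℕP.+-monoʳ-≤ a₅ i<L)
      5m≢2p : 5 ℕ.* m ≢ 2 ℕ.* p
      5m≢2p 5m≡2p = p∤* p∤5 (0<m<p⇒p∤m (s≤s z≤n) (ℕP.≤-<-trans m≤b b<p)) (subst (p ∣_) (sym 5m≡2p) (ℕ∣.n∣m*n 2))
    above : ∀ i → i < R → interval 5 1 (suc (a₅ ℕ.+ L ℕ.+ i)) ≡ + 0
    above i _ = interval-outside 5 1 m (λ (_ , 5m<2p) →
      ℕP.<⇒≱ (s≤s (ℕP.≤-trans (ℕP.≤-reflexive (sym a+L≡b)) (ℕP.m≤m+n (a₅ ℕ.+ L) i)))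
             (Equivalence.from (≤/⇔*≤ (2 ℕ.* p) 5) (subst (_≤ 2 ℕ.* p) (5*≡*5 m) (ℕP.<⇒≤ 5m<2p))))
      where
      m = suc (a₅ ℕ.+ L ℕ.+ i)

  W-harmonic : + 5 / 1 * toℚᵘ (W p) ≃ + 2 / 1 * H (interval 5 1)
  W-harmonic = begin
    + 5 / 1 * toℚᵘ (W p)                       ≈⟨ *-congˡ {+ 5 / 1} W≃harmonic ⟩
    + 5 / 1 * (mkℚᵘ (+ 2) 4 * ones)            ≈⟨ ≃-sym (*-assoc (+ 5 / 1) (mkℚᵘ (+ 2) 4) ones) ⟩
    (+ 5 / 1 * mkℚᵘ (+ 2) 4) * ones            ≈⟨ *-cong {+ 5 / 1 * mkℚᵘ (+ 2) 4} {+ 2 / 1} (*≡* refl)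
                                                         (≃-sym H-interval-5-1) ⟩
    + 2 / 1 * H (interval 5 1)                 ∎
    where
    open ≃-Reasoning
    ones = harmonic (λ _ → + 1) a₅ (b₅ ∸ a₅)

  cA : ℤ
  cA = + 2 ℤ.* legM1 (+ p)

  wA : ℕ → ℤ
  wA m = coeffA p (+ p ℤ.- + m)

  gA : ℕ → ℤ
  gA m = wA m ℤ.+ coeffA p (ℤ.- + m)

  termA≃ : ∀ j i → ℤ.∣ + p ℤ.- j ∣ ≡ suc i → toℚᵘ (termA p j) ≃ mkℚᵘ (coeffA p j) i
  termA≃ j i ∣p-j∣≡1+i with inClass p j
  ... | true  = subst (λ d → toℚᵘ (frac _ d) ≃ mkℚᵘ _ i) (sym ∣p-j∣≡1+i) (toℚᵘ-frac _ i)
  ... | false = *≡* refl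

  A≃harmonic : toℚᵘ (A p) ≃ cA / 1 * harmonic wA 0 (p ℕ.+ (p ∸ 1))
  A≃harmonic = begin
    toℚᵘ (A p)
      ≈⟨ ℚP.toℚᵘ-homo-* (frac cA 1) (sumℚ (map (termA p) (intRange p))) ⟩
    toℚᵘ (frac cA 1) * toℚᵘ (sumℚ (map (termA p) (intRange p)))
      ≈⟨ *-cong (toℚᵘ-frac cA 0) (toℚᵘ-sumℚ-map (termA p) φ n) ⟩
    cA / 1 * ∑ n (λ k → toℚᵘ (termA p (φ k)))
      ≈⟨ *-congˡ {cA / 1} (≃-sym (∑-reverse n _)) ⟩
    cA / 1 * ∑ n (λ i → toℚᵘ (termA p (φ (n ∸ suc i))))
      ≈⟨ *-congˡ {cA / 1} (∑-cong n (λ i i<n → ≃-trans (≃-reflexive (cong (toℚᵘ ∘ termA p) (φ-reversed i i<n)))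
                                                      (termA≃ _ i (∣p-[p-1-i]∣≡ i)))) ⟩
    cA / 1 * harmonic wA 0 n
      ≡⟨ cong (λ k → cA / 1 * harmonic wA 0 k) n≡ ⟩
    cA / 1 * harmonic wA 0 (p ℕ.+ (p ∸ 1)) ∎
    where
    open ≃-Reasoning
    n = 2 ℕ.* p ∸ 1
    φ : ℕ → ℤ
    φ k = + k ℤ.- + (p ∸ 1)
    n≡ : n ≡ p ℕ.+ (p ∸ 1)
    n≡ = trans (cong (λ k → p ℕ.+ k ∸ 1) (ℕP.+-identityʳ p)) (ℕP.+-∸-assoc p (ℕP.<-trans (s≤s z≤n) 5<p))
    φ-reversed : ∀ i → i < n → φ (n ∸ suc i) ≡ + p ℤ.- + suc i
    φ-reversed i i<n = trans (solve 3 (λ k s q → k :- q := (k :+ s) :- s :- q) refl (+ k) (+ suc i) (+ (p ∸ 1)))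
      (trans (cong (λ z → z ℤ.- + suc i ℤ.- + (p ∸ 1)) k+1+i≡)
             (solve 3 (λ p q s → p :+ q :- s :- q := p :- s) refl (+ p) (+ (p ∸ 1)) (+ suc i)))
      where
      open +-*-Solver
      k = n ∸ suc i
      k+1+i≡ : + k ℤ.+ + suc i ≡ + p ℤ.+ + (p ∸ 1)
      k+1+i≡ = trans (sym (ℤP.pos-+ k (suc i))) (trans (cong +_ (trans (ℕP.m∸n+n≡m i<n) n≡)) (ℤP.pos-+ p (p ∸ 1)))
    ∣p-[p-1-i]∣≡ : ∀ i → ℤ.∣ + p ℤ.- (+ p ℤ.- + suc i) ∣ ≡ suc i
    ∣p-[p-1-i]∣≡ i = cong ℤ.∣_∣ (solve 2 (λ p s → p :- (p :- s) := s) refl (+ p) (+ suc i))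
      where open +-*-Solver

  harmonic-wA-upper : harmonic wA p (p ∸ 1) ≈ H (λ m → coeffA p (ℤ.- + m))
  harmonic-wA-upper = begin
    harmonic wA p (p ∸ 1)
      ≡⟨ cong (λ a → harmonic wA a (p ∸ 1)) (sym (ℕP.*-identityˡ p)) ⟩
    harmonic wA (1 ℕ.* p) (p ∸ 1)
      ≈⟨ harmonic-shift wA 1 (p ∸ 1) p∸1<p ⟩
    harmonic (λ m → wA (1 ℕ.* p ℕ.+ m)) 0 (p ∸ 1)
      ≈⟨ ≃⇒≈ (harmonic-cong {λ m → wA (1 ℕ.* p ℕ.+ m)} {λ m → coeffA p (ℤ.- + m)} 0 (p ∸ 1)
                            (λ i _ → cong (coeffA p) (p-[p+m]≡-m (suc i)))) ⟩
    H (λ m → coeffA p (ℤ.- + m)) ∎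
    where
    open ≈-Reasoning
    p-[p+m]≡-m : ∀ m → + p ℤ.- + (1 ℕ.* p ℕ.+ m) ≡ ℤ.- + m
    p-[p+m]≡-m m = trans (cong (λ k → + p ℤ.- + (k ℕ.+ m)) (ℕP.*-identityˡ p))
      (trans (cong (ℤ._-_ (+ p)) (ℤP.pos-+ p m)) (solve 2 (λ p m → p :- (p :+ m) := :- m) refl (+ p) (+ m)))
      where open +-*-Solver

  A-harmonic : toℚᵘ (A p) ≈ cA / 1 * H gA
  A-harmonic = begin
    toℚᵘ (A p)
      ≈⟨ ≃⇒≈ A≃harmonic ⟩
    cA / 1 * harmonic wA 0 (p ℕ.+ (p ∸ 1))
      ≈⟨ ≃⇒≈ (*-congˡ {cA / 1} (harmonic-split wA 0 p (p ∸ 1))) ⟩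
    cA / 1 * (harmonic wA 0 p + harmonic wA p (p ∸ 1))
      ≈⟨ *-congˡ-≈ cA (+-cong-≈ (≃⇒≈ (harmonic-dropLastₚ wA 0 wA[p]≡0)) harmonic-wA-upper) ⟩
    cA / 1 * (H wA + H (λ m → coeffA p (ℤ.- + m)))
      ≈⟨ ≃⇒≈ (*-congˡ {cA / 1} (≃-sym (harmonic-+ wA (λ m → coeffA p (ℤ.- + m)) 0 (p ∸ 1)))) ⟩
    cA / 1 * H gA ∎
    where
    open ≈-Reasoning
    wA[p]≡0 : wA (0 ℕ.+ p) ≡ + 0
    wA[p]≡0 = trans (cong (coeffA p) (ℤP.+-inverseʳ (+ p))) (coeffA-0 p)

  q : ℕ
  q = p % 20

  σ : ℕ → ℕ
  σ m = (20 ℕ.* m) ℕ./ p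

  σ<20 : ∀ {m} → m < p → σ m < 20
  σ<20 m<p = m<n*o⇒m/o<n (ℕP.*-monoʳ-< 20 m<p)

  p∤20m : ∀ {m} → 0 < m → m < p → p ∤ 20 ℕ.* m
  p∤20m 0<m m<p = p∤* (p∤* p∤2 (p∤* p∤2 p∤5)) (0<m<p⇒p∤m 0<m m<p)
    where
    p∤2 : p ∤ 2
    p∤2 = ℕ∣.>⇒∤ (ℕP.<-trans (s≤s (s≤s (s≤s z≤n))) 5<p)

  interval-profile : ∀ {c N} .{{_ : NonZero c}} t {m} → c ℕ.* N ≡ 20 → 0 < m → m < p →
                     interval N t m ≡ intervalAt c t (σ m)
  interval-profile {c} {N} t {m} cN≡20 0<m m<p =
    𝟙-cong (window t (N ℕ.* m)) ((c ℕ.* t ≤? σ m) ×-dec (σ m <? c ℕ.* suc t)) (lower ×-⇔ upper)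
    where
    cNm≡20m : c ℕ.* (N ℕ.* m) ≡ 20 ℕ.* m
    cNm≡20m = trans (sym (ℕP.*-assoc c N m)) (cong (ℕ._* m) cN≡20)
    scale : ∀ {a b} → a < b ⇔ c ℕ.* a < c ℕ.* b
    scale {a} {b} = mk⇔ (ℕP.*-monoʳ-< c) (ℕP.*-cancelˡ-< c a b)
    lower : t ℕ.* p < N ℕ.* m ⇔ c ℕ.* t ≤ σ m
    lower = ⇔-trans scale (⇔-trans (≡⇒⇔ (cong₂ _<_ (sym (ℕP.*-assoc c t p)) cNm≡20m))
              (⇔-trans (mk⇔ ℕP.<⇒≤ (λ le → ℕP.≤∧≢⇒< le (λ eq → p∤20m 0<m m<p (subst (p ∣_) eq (ℕ∣.n∣m*n (c ℕ.* t))))))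
                       (⇔-sym (≤/⇔*≤ (20 ℕ.* m) p))))
    upper : N ℕ.* m < suc t ℕ.* p ⇔ σ m < c ℕ.* suc t
    upper = ⇔-trans scale (⇔-trans (≡⇒⇔ (cong₂ _<_ cNm≡20m (sym (ℕP.*-assoc c (suc t) p))))
              (⇔-sym (/<⇔<* (20 ℕ.* m) p)))

  20∣p-q : + 20 ℤ∣.∣ + p ℤ.- + q
  20∣p-q = %ℕ-spec (+ p) 20

  20∣[a-b]-[c-d] : ∀ a b c d → + 20 ℤ∣.∣ a ℤ.- c → + 20 ℤ∣.∣ b ℤ.- d → + 20 ℤ∣.∣ (a ℤ.- b) ℤ.- (c ℤ.- d)
  20∣[a-b]-[c-d] a b c d 20∣a-c 20∣b-d = subst (+ 20 ℤ∣.∣_)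
    (solve 4 (λ a b c d → (a :- c) :- (b :- d) := (a :- b) :- (c :- d)) refl a b c d) (ℤ∣.∣m∣n⇒∣m-n 20∣a-c 20∣b-d)
    where open +-*-Solver

  progression-profile : ∀ N .{{_ : NonZero N}} t m → N ∣ 20 →
                        progression N t m ≡ + N ℤ.* 𝟙 (N ∣? m % 20 ℕ.+ t ℕ.* q)
  progression-profile N t m N∣20 = cong (+ N ℤ.*_) (𝟙-cong (N ∣? _) (N ∣? _) (%≡⇒∣⇔ N
    (%ℕ-cong N∣20 (+ (m ℕ.+ t ℕ.* p)) (+ (m % 20 ℕ.+ t ℕ.* q)) (subst (+ 20 ℤ∣.∣_) (sym difference)
      (ℤ∣.∣m∣n⇒∣m+n (%ℕ-spec (+ m) 20) (ℤ∣.∣n⇒∣m*n (+ t) 20∣p-q))))))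
    where
    pos-lin : ∀ a b c → + (a ℕ.+ b ℕ.* c) ≡ + a ℤ.+ + b ℤ.* + c
    pos-lin a b c = trans (ℤP.pos-+ a (b ℕ.* c)) (cong (ℤ._+_ (+ a)) (ℤP.pos-* b c))
    difference : + (m ℕ.+ t ℕ.* p) ℤ.- + (m % 20 ℕ.+ t ℕ.* q) ≡ (+ m ℤ.- + (m % 20)) ℤ.+ + t ℤ.* (+ p ℤ.- + q)
    difference = trans (cong₂ ℤ._-_ (pos-lin m t p) (pos-lin (m % 20) t q))
      (solve 5 (λ m r t p q → m :+ t :* p :- (r :+ t :* q) := (m :- r) :+ t :* (p :- q)) refl
               (+ m) (+ (m % 20)) (+ t) (+ p) (+ q))
      where open +-*-Solver

  p≡q[mod_] : ∀ d .{{_ : NonZero d}} → d ∣ 20 → p % d ≡ q % d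
  p≡q[mod d ] d∣20 = sym (m∣n⇒o%n%m≡o%m d 20 p d∣20)

  cA-profile : cA ≡ + 2 ℤ.* legM1 (+ q)
  cA-profile = cong (+ 2 ℤ.*_) (legM1-cong {+ p} {+ q} (p≡q[mod 4 ] (ℕ∣.divides 5 refl)))

  gA-profile : ∀ m → gA m ≡ coeffA q (+ q ℤ.- + (m % 20)) ℤ.+ coeffA q (ℤ.- + (m % 20))
  gA-profile m = cong₂ ℤ._+_
    (coeffA-cong {p} {q} p≡q[mod5]
                 (20∣[a-b]-[c-d] (+ p) (+ m) (+ q) (+ (m % 20)) 20∣p-q (%ℕ-spec (+ m) 20)))
    (coeffA-cong {p} {q} {ℤ.- + m} {ℤ.- + (m % 20)} p≡q[mod5]
                 (subst (+ 20 ℤ∣.∣_) (solve 2 (λ m r → :- (m :- r) := :- m :- (:- r)) refl (+ m) (+ (m % 20)))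
                        (ℤ∣.∣m⇒∣-m (%ℕ-spec (+ m) 20))))
    where
    open +-*-Solver
    p≡q[mod5] = p≡q[mod 5 ] (ℕ∣.divides 4 refl)

  [p∸m]%20-profile : ∀ {m} → m ≤ p → (p ∸ m) % 20 ≡ (+ q ℤ.- + (m % 20)) %ℕ 20
  [p∸m]%20-profile {m} m≤p = %ℕ-cong {20} ℕ∣.∣-refl (+ (p ∸ m)) (+ q ℤ.- + (m % 20))
    (subst (λ x → + 20 ℤ∣.∣ x ℤ.- (+ q ℤ.- + (m % 20))) (trans (ℤP.[+m]-[+n]≡m⊖n p m) (ℤP.⊖-≥ m≤p))
           (20∣[a-b]-[c-d] (+ p) (+ m) (+ q) (+ (m % 20)) 20∣p-q (%ℕ-spec (+ m) 20)))

  open Certificate (certificate q) using (relations; mirror)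

  combination : List Entry → ℕ → ℤ
  combination []                  m = + 0
  combination (μ ·⟨ M , t ⟩ ∷ es) m = μ ℤ.* relation (modulus M) t m ℤ.+ combination es m

  Null-combination : ∀ es → All Valid es → Null (combination es)
  Null-combination []                  All.[]            = ≃⇒≈ (harmonic-vanish (λ _ → + 0) 0 (p ∸ 1) (λ _ _ → refl))
  Null-combination (μ ·⟨ M , t ⟩ ∷ es) (t<N All.∷ valid) =
    Null-+ {λ m → μ ℤ.* relation (modulus M) t m} {combination es}
           (Null-*ˡ μ {relation (modulus M) t} (Null-relation (modulus M) {{modulus-nonZero M}} t t<N))
           (Null-combination es valid)

  X : ℕ → ℤ
  X m = lookupOr0 mirror (m % 20)

  combination-profile : ∀ es m → 0 < m → m < p → combination es m ≡ combinationAt es q (m % 20) (σ m)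
  combination-profile []                  m 0<m m<p = refl
  combination-profile (μ ·⟨ M , t ⟩ ∷ es) m 0<m m<p = cong₂ (λ x y → μ ℤ.* x ℤ.+ y)
    (cong₂ ℤ._-_ (interval-profile {{cofactor-nonZero M}} t (cofactor*modulus M) 0<m m<p)
                 (progression-profile (modulus M) {{modulus-nonZero M}} t m (modulus∣20 M)))
    (combination-profile es m 0<m m<p)

  divides-q⇒divides-p : ∀ d .{{_ : NonZero d}} → d ∣ 20 → d ∣ q → d ∣ p
  divides-q⇒divides-p d d∣20 = Equivalence.from (%≡⇒∣⇔ d (p≡q[mod d ] d∣20))

  ¬∣p : ∀ d .{{_ : ℕ.NonTrivial d}} → d < p → ¬ d ∣ p
  ¬∣p d d<p d∣p = prime⇒¬composite p-prime (composite-≢ d (ℕP.<⇒≢ d<p) d∣p)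

  checks-q : Checks q
  checks-q with certificate-checks (fromℕ< (m%n<n p 20)) | toℕ-fromℕ< (m%n<n p 20)
  ... | inj₁ 2∣q        | eq = contradiction (divides-q⇒divides-p 2 (ℕ∣.divides 10 refl) (subst (2 ∣_) eq 2∣q))
                                             (¬∣p 2 (ℕP.<-trans (s≤s (s≤s (s≤s z≤n))) 5<p))
  ... | inj₂ (inj₁ 5∣q) | eq = contradiction (divides-q⇒divides-p 5 (ℕ∣.divides 4 refl) (subst (5 ∣_) eq 5∣q))
                                             (¬∣p 5 5<p)
  ... | inj₂ (inj₂ ok)  | eq = subst Checks eq ok

  remainder : ℕ → ℤ
  remainder m = combination relations m ℤ.+ (X m ℤ.+ X (p ∸ m))

  Null-remainder : Null remainder
  Null-remainder = Null-+ {combination relations} {λ m → X m ℤ.+ X (p ∸ m)}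
                          (Null-combination relations (proj₁ checks-q)) (Null-mirror X)

  pointwise : ∀ m → 0 < m → m < p → (+ 5 ℤ.* cA) ℤ.* gA m ≡ + 2 ℤ.* interval 5 1 m ℤ.+ remainder m
  pointwise m 0<m m<p = begin
    (+ 5 ℤ.* cA) ℤ.* gA m
      ≡⟨ cong₂ (λ c g → (+ 5 ℤ.* c) ℤ.* g) cA-profile (gA-profile m) ⟩
    lhsAt q (m % 20)
      ≡⟨ subst₂ (λ r s → lhsAt q r ≡ rhsAt q r s) (toℕ-fromℕ< r<20) (toℕ-fromℕ< (σ<20 m<p))
                (proj₂ checks-q (fromℕ< r<20) (fromℕ< (σ<20 m<p))) ⟩
    rhsAt q (m % 20) (σ m)
      ≡⟨ sym (cong₂ (λ i c → + 2 ℤ.* i ℤ.+ c) (interval-profile {4} {5} 1 refl 0<m m<p)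
               (cong₂ ℤ._+_ (combination-profile relations m 0<m m<p)
                            (cong (λ k → lookupOr0 mirror (m % 20) ℤ.+ lookupOr0 mirror k) ([p∸m]%20-profile (ℕP.<⇒≤ m<p))))) ⟩
    + 2 ℤ.* interval 5 1 m ℤ.+ remainder m ∎
    where
    open ≡-Reasoning
    r<20 = m%n<n m 20

  H-gA : H (λ m → (+ 5 ℤ.* cA) ℤ.* gA m) ≈ + 2 / 1 * H (interval 5 1)
  H-gA = begin
    H f                       ≈⟨ ≃⇒≈ (harmonic-cong {f} {λ m → g m ℤ.+ remainder m} 0 (p ∸ 1) (λ i i<p-1 →
                                   pointwise (suc i) (s≤s z≤n) (subst (suc i <_) (sym p≡1+[p∸1]) (s≤s i<p-1)))) ⟩
    H (λ m → g m ℤ.+ remainder m)  ≈⟨ ≃⇒≈ (harmonic-+ g remainder 0 (p ∸ 1)) ⟩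
    H g + H remainder         ≈⟨ +-cong-≈ (≈-refl {H g}) Null-remainder ⟩
    H g + 0ℚᵘ                 ≈⟨ ≃⇒≈ (+-identityʳ (H g)) ⟩
    H g                       ≈⟨ ≃⇒≈ (harmonic-*ˡ (+ 2) (interval 5 1) 0 (p ∸ 1)) ⟩
    + 2 / 1 * H (interval 5 1) ∎
    where
    open ≈-Reasoning
    f g : ℕ → ℤ
    f m = (+ 5 ℤ.* cA) ℤ.* gA m
    g m = + 2 ℤ.* interval 5 1 m

  A≈W : toℚᵘ (A p) ≈ toℚᵘ (W p)
  A≈W = *-cancelˡ-≈ 4 p∤5 (begin
    + 5 / 1 * toℚᵘ (A p)              ≈⟨ *-congˡ-≈ (+ 5) A-harmonic ⟩
    + 5 / 1 * (cA / 1 * H gA)         ≈⟨ ≃⇒≈ (≃-trans (≃-sym (*-assoc (+ 5 / 1) (cA / 1) (H gA)))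
                                                      (≃-sym (harmonic-*ˡ (+ 5 ℤ.* cA) gA 0 (p ∸ 1)))) ⟩
    H (λ m → (+ 5 ℤ.* cA) ℤ.* gA m)   ≈⟨ H-gA ⟩
    + 2 / 1 * H (interval 5 1)        ≈⟨ ≃⇒≈ (≃-sym W-harmonic) ⟩
    + 5 / 1 * toℚᵘ (W p)              ∎)
    where open ≈-Reasoning

mainTheorem1 : (p : ℕ) → Prime p → 5 < p →
    (A p ≡ W p [modℚ p ]) ×
    (fibQuot p ≡ A p [modℚ p ] → fibQuot p ≡ W p [modℚ p ])
mainTheorem1 p p-prime 5<p =
    from (≡[modℚ]⇔≈ (A p) (W p)) A≈W
  , λ F≡A → from (≡[modℚ]⇔≈ (fibQuot p) (W p)) (≈-trans (to (≡[modℚ]⇔≈ (fibQuot p) (A p)) F≡A) A≈W)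
  where
  open Congruence p p-prime
  open Theorem p p-prime 5<p
  open Equivalence
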